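{- Let $n\geq 1$ and let $\sigma$ be any permutation of $I_n$ belonging to the group generated by $i\mapsto i+1\bmod n$ and $i\mapsto n-1-i$. If a simplicial complex $K$ on $I_n$ generates $\mathsf{Mon}_n$, then the complex $\sigma\cdot K=\{\sigma(S):S\in K\}$ generates $\mathsf{Mon}_n$.
   Context: For finite sets $A,I$, a language is a subset $L\subseteq A^I$. For finite sets $B,J$ and a function $f:B^J\to A^I$, the input window $\mathcal{W}_f(i)\subseteq J$ of $i\in I$ is the smallest $W\subseteq J$ such that for all $x,y\in B^J$ agreeing on $W$, $f(x)_i=f(y)_i$. The communication complex $K_f$ is the simplicial complex on vertex set $I$ whose simplices are the sets $S\subseteq I$ with $\bigcap_{i\in S}\mathcal{W}_f(i)\neq\emptyset$. A simplicial complex $K$ on $I$ generates $L$ if there exist finite sets $B,J$ and $f:B^J\to A^I$ with $f(B^J)=L$ and $K_f\subseteq K$. $\mathsf{Mon}_n\subseteq\{0,1\}^n$ is the set of binary strings $x_0\ldots x_{n-1}$ that are non-decreasing or non-increasing; positions are $I_n=\{0,\ldots,n-1\}$. -}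

module Defs where

open import Data.Nat as ℕ using (ℕ; zero; suc)
open import Data.Nat.DivMod using (_%_; m%n<n)
open import Data.Fin as Fin using (Fin; toℕ; fromℕ<; opposite)
open import Data.Fin.Subset using (Subset; _∈_; _⊆_)
open import Data.Bool using (Bool)
import Data.Bool as B
open import Data.Product using (Σ; ∃; _×_; _,_)
open import Data.Sum using (_⊎_)
open import Relation.Binary.PropositionalEquality using (_≡_)
open import Function using (_∘_; id)

IsSimplicialComplex : ∀ {n} → (Subset n → Set) → Set
IsSimplicialComplex {n} K = ∀ (S T : Subset n) → T ⊆ S → K S → K T

Language : Set → ℕ → Set₁
Language A n = (Fin n → A) → Set

Sufficient : ∀ {A : Set} {b j n} → ((Fin j → Fin b) → (Fin n → A)) →
             Fin n → Subset j → Set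
Sufficient f i W = ∀ x y → (∀ k → k ∈ W → x k ≡ y k) → f x i ≡ f y i

-- Membership in the input window W_f(i): the smallest sufficient set,
-- i.e. the intersection of all sufficient sets.
InWindow : ∀ {A : Set} {b j n} → ((Fin j → Fin b) → (Fin n → A)) →
           Fin n → Fin j → Set
InWindow {j = j} f i k = ∀ (W : Subset j) → Sufficient f i W → k ∈ W

InCommComplex : ∀ {A : Set} {b j n} → ((Fin j → Fin b) → (Fin n → A)) →
                Subset n → Set
InCommComplex {j = j} f S = Σ (Fin j) λ k → ∀ i → i ∈ S → InWindow f i k

-- K generates L: some f : B^J → A^I (B, J finite, here Fin b, Fin j)
-- with f(B^J) = L and K_f ⊆ K.
Generates : ∀ {A : Set} {n} → (Subset n → Set) → Language A n → Set
Generates {A} {n} K L =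
  Σ ℕ λ b → Σ ℕ λ j → Σ ((Fin j → Fin b) → (Fin n → A)) λ f →
    ((∀ x → L (f x)) ×
     (∀ y → L y → Σ (Fin j → Fin b) λ x → ∀ i → f x i ≡ y i)) ×
    (∀ S → InCommComplex f S → K S)

NonDecreasing NonIncreasing : ∀ {n} → (Fin n → Bool) → Set
NonDecreasing x = ∀ i j → i Fin.≤ j → x i B.≤ x j
NonIncreasing x = ∀ i j → i Fin.≤ j → x j B.≤ x i

Mon : (n : ℕ) → Language Bool n
Mon n x = NonDecreasing x ⊎ NonIncreasing x

rot : ∀ {n} → Fin n → Fin n
rot {suc m} i = fromℕ< (m%n<n (suc (toℕ i)) (suc m))

refl' : ∀ {n} → Fin n → Fin n
refl' = opposite

data InDihedral {n : ℕ} : (Fin n → Fin n) → Set where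
  gen-rot  : InDihedral rot
  gen-refl : InDihedral refl'
  gen-id   : InDihedral id
  gen-comp : ∀ {f g} → InDihedral f → InDihedral g → InDihedral (f ∘ g)
  gen-inv  : ∀ {f g} → InDihedral f → (∀ x → g (f x) ≡ x) →
             (∀ x → f (g x) ≡ x) → InDihedral g
  gen-ext  : ∀ {f g} → InDihedral f → (∀ x → f x ≡ g x) → InDihedral g

act : ∀ {n} → (Fin n → Fin n) → (Subset n → Set) → Subset n → Set
act {n} σ K S = Σ (Subset n) λ T → K T ×
  (∀ i → (i ∈ S → Σ (Fin n) λ t → t ∈ T × σ t ≡ i) ×
         ((Σ (Fin n) λ t → t ∈ T × σ t ≡ i) → i ∈ S))

-- A dihedral permutation σ of the positions is realised on {0,1}^n by a signed
-- permutation x ↦ (i ↦ s i ⊕ x (σ⁻¹ i)) mapping Mon_n onto itself: the reflection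
-- reverses strings, and the rotation becomes x ↦ ¬x_{n-1} x_0 … x_{n-2}, which
-- keeps a monotone string monotone (possibly switching its direction).
-- Post-composing a generator f of Mon_n with such a map only relabels the output
-- coordinates, so the window of output σ t is contained in the old window of t and
-- every simplex of the new communication complex is σ applied to a simplex of K.
module Submission where

open import Defs
open import Data.Nat using (ℕ; _≥_)
open import Data.Fin using (Fin)
open import Data.Fin.Subset using (Subset)

open import Data.Nat as ℕ using (zero; suc; s≤s; z≤n)
import Data.Nat.Properties as ℕ
open import Data.Nat.DivMod using (m<n⇒m%n≡m; n%n≡0)
open import Data.Fin as F using (zero; suc; toℕ; fromℕ; inject₁; opposite)
import Data.Fin.Properties as F
open import Data.Fin.Relation.Unary.Top using (view; ‵fromℕ; ‵inject₁)
open import Data.Fin.Subset using (_∈_)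
open import Data.Bool using (Bool; true; false; not; _xor_)
import Data.Bool as B
open import Data.Bool.Properties
  using (≤-refl; ≤-minimum; ≤-maximum; ≤-trans; not-involutive; not-distribʳ-xor; xor-assoc;
         xor-comm; xor-same)
open import Data.Vec using (lookup; tabulate)
open import Data.Vec.Properties using (lookup∘tabulate; []=⇒lookup; lookup⇒[]=)
open import Data.Product using (Σ; _×_; _,_)
open import Data.Sum using (inj₁; inj₂)
open import Data.Empty using (⊥-elim)
open import Relation.Nullary using (¬_)
open import Relation.Binary.Definitions using (Reflexive; _Respects_)
open import Relation.Binary.PropositionalEquality
open import Function using (_∘_; id; flip; const)

private
  variable
    m n : ℕ

Sorted : {A : Set} → (A → A → Set) → (Fin n → A) → Set
Sorted R x = ∀ i j → i F.≤ j → R (x i) (x j)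

module _ {A : Set} (R : A → A → Set) where

  Sorted-resp-≗ : (Sorted {n = n} R) Respects _≗_
  Sorted-resp-≗ x≗y x↑ i j i≤j = subst₂ R (x≗y i) (x≗y j) (x↑ i j i≤j)

  Sorted-∘ : {x : Fin n → A} {g : Fin m → Fin n} →
             (∀ {i j} → i F.≤ j → g i F.≤ g j) → Sorted R x → Sorted R (x ∘ g)
  Sorted-∘ g-mono x↑ i j i≤j = x↑ _ _ (g-mono i≤j)

  Sorted-cons : {x : Fin (suc m) → A} → Reflexive R →
                (∀ j → R (x zero) (x (suc j))) → Sorted R (x ∘ suc) → Sorted R x
  Sorted-cons R-refl head tail zero    zero    _         = R-refl
  Sorted-cons R-refl head tail zero    (suc j) _         = head j
  Sorted-cons R-refl head tail (suc i) (suc j) (s≤s i≤j) = tail i j i≤j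

  Sorted-snoc : {x : Fin (suc m) → A} → Reflexive R →
                (∀ i → R (x (inject₁ i)) (x (fromℕ m))) → Sorted R (x ∘ inject₁) →
                Sorted R x
  Sorted-snoc R-refl last init i j i≤j with view i | view j
  ... | ‵fromℕ      | ‵fromℕ      = R-refl
  ... | ‵inject₁ i′ | ‵fromℕ      = last i′
  ... | ‵fromℕ      | ‵inject₁ j′ = ⊥-elim (fromℕ≰inject₁ i≤j)
    where
    fromℕ≰inject₁ : ¬ fromℕ _ F.≤ inject₁ j′
    fromℕ≰inject₁ le = ℕ.<⇒≱ (F.inject₁ℕ< j′) (subst (ℕ._≤ toℕ (inject₁ j′)) (F.toℕ-fromℕ _) le)
  ... | ‵inject₁ i′ | ‵inject₁ j′ =
    init i′ j′ (subst₂ ℕ._≤_ (F.toℕ-inject₁ i′) (F.toℕ-inject₁ j′) i≤j)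

inject₁-mono-≤ : {i j : Fin n} → i F.≤ j → inject₁ i F.≤ inject₁ j
inject₁-mono-≤ {i = i} {j} = subst₂ ℕ._≤_ (sym (F.toℕ-inject₁ i)) (sym (F.toℕ-inject₁ j))

opposite-anti-≤ : {i j : Fin n} → i F.≤ j → opposite j F.≤ opposite i
opposite-anti-≤ {n} {i} {j} i≤j rewrite F.opposite-prop i | F.opposite-prop j =
  ℕ.∸-monoʳ-≤ n (s≤s i≤j)

not-anti-≤ : {a b : Bool} → a B.≤ b → not b B.≤ not a
not-anti-≤ B.b≤b = B.b≤b
not-anti-≤ B.f≤t = B.f≤t

Mon-resp-≗ : Mon n Respects _≗_
Mon-resp-≗ x≗y (inj₁ x↑) = inj₁ (Sorted-resp-≗ B._≤_ x≗y x↑)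
Mon-resp-≗ x≗y (inj₂ x↓) = inj₂ (Sorted-resp-≗ (flip B._≤_) x≗y x↓)

Mon-complement : {x : Fin n → Bool} → Mon n x → Mon n (not ∘ x)
Mon-complement (inj₁ x↑) = inj₂ λ i j i≤j → not-anti-≤ (x↑ i j i≤j)
Mon-complement (inj₂ x↓) = inj₁ λ i j i≤j → not-anti-≤ (x↓ i j i≤j)

Mon-reverse : {x : Fin n → Bool} → Mon n x → Mon n (x ∘ opposite)
Mon-reverse (inj₁ x↑) = inj₂ λ i j i≤j → x↑ _ _ (opposite-anti-≤ i≤j)
Mon-reverse (inj₂ x↓) = inj₁ λ i j i≤j → x↓ _ _ (opposite-anti-≤ i≤j)

nonDecreasing-last-false : {x : Fin (suc m) → Bool} → NonDecreasing x →
                           x (fromℕ m) ≡ false → NonIncreasing x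
nonDecreasing-last-false {m} {x} x↑ x-last i j _ =
  ≤-trans (subst (x j B.≤_) x-last (x↑ j (fromℕ m) (F.≤fromℕ j))) (≤-minimum (x i))

nonDecreasing-first-true : {x : Fin (suc m) → Bool} → NonDecreasing x →
                           x zero ≡ true → NonIncreasing x
nonDecreasing-first-true {x = x} x↑ x-first i j _ =
  ≤-trans (≤-maximum (x j)) (subst (B._≤ x i) x-first (x↑ zero i z≤n))

signedAct : (Fin n → Bool) → (Fin n → Fin n) → (Fin n → Bool) → Fin n → Bool
signedAct s τ x i = s i xor x (τ i)

signedAct-cong : {s s′ : Fin n → Bool} {τ τ′ : Fin n → Fin n} →
                 s ≗ s′ → τ ≗ τ′ → ∀ x → signedAct s τ x ≗ signedAct s′ τ′ x
signedAct-cong s≗s′ τ≗τ′ x i = cong₂ _xor_ (s≗s′ i) (cong x (τ≗τ′ i))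

signedAct-∘ : ∀ (s : Fin n → Bool) τ s′ τ′ x →
              signedAct s τ (signedAct s′ τ′ x) ≗ signedAct (λ i → s i xor s′ (τ i)) (τ′ ∘ τ) x
signedAct-∘ s τ s′ τ′ x i = sym (xor-assoc (s i) (s′ (τ i)) (x (τ′ (τ i))))

signedAct-inverse : ∀ (s : Fin n → Bool) {σ τ} → (∀ i → σ (τ i) ≡ i) →
                    ∀ y → signedAct s τ (signedAct (s ∘ σ) σ y) ≗ y
signedAct-inverse s {σ} {τ} σ∘τ y i = begin
  s i xor (s (σ (τ i)) xor y (σ (τ i))) ≡⟨ cong (λ k → s i xor (s k xor y k)) (σ∘τ i) ⟩
  s i xor (s i xor y i)                 ≡⟨ xor-assoc (s i) (s i) (y i) ⟨
  (s i xor s i) xor y i                 ≡⟨ cong (_xor y i) (xor-same (s i)) ⟩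
  y i                                   ∎
  where open ≡-Reasoning

-- A signed permutation commutes with complementation, which swaps the two
-- directions of monotonicity.
Mon-signedAct : ∀ (s : Fin n → Bool) τ → (∀ x → NonDecreasing x → Mon n (signedAct s τ x)) →
                ∀ x → Mon n x → Mon n (signedAct s τ x)
Mon-signedAct s τ act↑ x (inj₁ x↑) = act↑ x x↑
Mon-signedAct s τ act↑ x (inj₂ x↓) =
  Mon-resp-≗ complement-twice (Mon-complement (act↑ (not ∘ x) λ i j i≤j → not-anti-≤ (x↓ i j i≤j)))
  where
  complement-twice : not ∘ signedAct s τ (not ∘ x) ≗ signedAct s τ x
  complement-twice i = trans (not-distribʳ-xor (s i) (not (x (τ i))))
                             (cong (s i xor_) (not-involutive (x (τ i))))

-- signedAct (sign ∘ σ) σ is the inverse of signedAct sign σ⁻¹, so L is mapped onto itself.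

record SignedSymmetry (L : Language Bool n) (σ : Fin n → Fin n) : Set where
  field
    σ⁻¹         : Fin n → Fin n
    σ⁻¹∘σ       : ∀ i → σ⁻¹ (σ i) ≡ i
    σ∘σ⁻¹       : ∀ i → σ (σ⁻¹ i) ≡ i
    sign        : Fin n → Bool
    preserves   : ∀ x → L x → L (signedAct sign σ⁻¹ x)
    preserves⁻¹ : ∀ y → L y → L (signedAct (sign ∘ σ) σ y)

module _ {L : Language Bool n} (L-resp : L Respects _≗_) where

  signedSymmetry-id : SignedSymmetry L id
  signedSymmetry-id = record
    { σ⁻¹ = id ; σ⁻¹∘σ = λ _ → refl ; σ∘σ⁻¹ = λ _ → refl ; sign = const false
    ; preserves = λ _ x∈L → x∈L ; preserves⁻¹ = λ _ y∈L → y∈L }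

  signedSymmetry-∘ : {σ₁ σ₂ : Fin n → Fin n} →
                     SignedSymmetry L σ₁ → SignedSymmetry L σ₂ → SignedSymmetry L (σ₁ ∘ σ₂)
  signedSymmetry-∘ {σ₁} {σ₂} G₁ G₂ = record
    { σ⁻¹ = τ₂ ∘ τ₁
    ; σ⁻¹∘σ = λ i → trans (cong τ₂ (τ₁∘σ₁ (σ₂ i))) (τ₂∘σ₂ i)
    ; σ∘σ⁻¹ = λ i → trans (cong σ₁ (σ₂∘τ₂ (τ₁ i))) (σ₁∘τ₁ i)
    ; sign = sign
    ; preserves = λ x x∈L → L-resp (signedAct-∘ s₁ τ₁ s₂ τ₂ x) (pres₁ _ (pres₂ x x∈L))
    ; preserves⁻¹ = λ y y∈L →
        L-resp (λ i → trans (signedAct-∘ (s₂ ∘ σ₂) σ₂ (s₁ ∘ σ₁) σ₁ y i)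
                            (signedAct-cong {τ = σ₁ ∘ σ₂} sign-∘ (λ _ → refl) y i))
               (pres₂⁻¹ _ (pres₁⁻¹ y y∈L))
    }
    where
    open SignedSymmetry G₁ renaming (σ⁻¹ to τ₁; σ⁻¹∘σ to τ₁∘σ₁; σ∘σ⁻¹ to σ₁∘τ₁;
      sign to s₁; preserves to pres₁; preserves⁻¹ to pres₁⁻¹)
    open SignedSymmetry G₂ renaming (σ⁻¹ to τ₂; σ⁻¹∘σ to τ₂∘σ₂; σ∘σ⁻¹ to σ₂∘τ₂;
      sign to s₂; preserves to pres₂; preserves⁻¹ to pres₂⁻¹)
    sign : Fin n → Bool
    sign i = s₁ i xor s₂ (τ₁ i)
    sign-∘ : (λ j → s₂ (σ₂ j) xor s₁ (σ₁ (σ₂ j))) ≗ sign ∘ σ₁ ∘ σ₂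
    sign-∘ j = trans (xor-comm (s₂ (σ₂ j)) _)
                     (cong (λ k → s₁ (σ₁ (σ₂ j)) xor s₂ k) (sym (τ₁∘σ₁ (σ₂ j))))

  signedSymmetry-inverse : {σ σ′ : Fin n → Fin n} → SignedSymmetry L σ →
                           (∀ i → σ′ (σ i) ≡ i) → (∀ i → σ (σ′ i) ≡ i) → SignedSymmetry L σ′
  signedSymmetry-inverse {σ} {σ′} G σ′∘σ σ∘σ′ = record
    { σ⁻¹ = σ ; σ⁻¹∘σ = σ∘σ′ ; σ∘σ⁻¹ = σ′∘σ ; sign = sign ∘ σ
    ; preserves = preserves⁻¹
    ; preserves⁻¹ = λ y y∈L →
        L-resp (signedAct-cong (cong sign ∘ sym ∘ σ∘σ′) σ⁻¹≗σ′ y) (preserves y y∈L)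
    }
    where
    open SignedSymmetry G
    σ⁻¹≗σ′ : σ⁻¹ ≗ σ′
    σ⁻¹≗σ′ i = trans (cong σ⁻¹ (sym (σ∘σ′ i))) (σ⁻¹∘σ (σ′ i))

  signedSymmetry-≗ : {σ σ′ : Fin n → Fin n} → SignedSymmetry L σ → σ ≗ σ′ → SignedSymmetry L σ′
  signedSymmetry-≗ G σ≗σ′ = record
    { σ⁻¹ = σ⁻¹ ; σ⁻¹∘σ = λ i → trans (cong σ⁻¹ (sym (σ≗σ′ i))) (σ⁻¹∘σ i)
    ; σ∘σ⁻¹ = λ i → trans (sym (σ≗σ′ (σ⁻¹ i))) (σ∘σ⁻¹ i) ; sign = sign
    ; preserves = preserves
    ; preserves⁻¹ = λ y y∈L → L-resp (signedAct-cong (cong sign ∘ σ≗σ′) σ≗σ′ y) (preserves⁻¹ y y∈L)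
    }
    where open SignedSymmetry G

signedSymmetry-opposite : SignedSymmetry (Mon n) refl'
signedSymmetry-opposite = record
  { σ⁻¹ = opposite ; σ⁻¹∘σ = F.opposite-involutive ; σ∘σ⁻¹ = F.opposite-involutive
  ; sign = const false ; preserves = λ _ → Mon-reverse ; preserves⁻¹ = λ _ → Mon-reverse }

rot-inject₁ : (j : Fin m) → rot (inject₁ j) ≡ suc j
rot-inject₁ {m} j = F.toℕ-injective (begin
  toℕ (rot (inject₁ j))             ≡⟨ F.toℕ-fromℕ< _ ⟩
  suc (toℕ (inject₁ j)) ℕ.% suc m   ≡⟨ m<n⇒m%n≡m (s≤s (F.inject₁ℕ< j)) ⟩
  suc (toℕ (inject₁ j))             ≡⟨ cong suc (F.toℕ-inject₁ j) ⟩
  toℕ (suc j)                       ∎)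
  where open ≡-Reasoning

rot-fromℕ : rot (fromℕ m) ≡ zero
rot-fromℕ {m} = F.toℕ-injective (begin
  toℕ (rot (fromℕ m))               ≡⟨ F.toℕ-fromℕ< _ ⟩
  suc (toℕ (fromℕ m)) ℕ.% suc m     ≡⟨ cong (λ k → suc k ℕ.% suc m) (F.toℕ-fromℕ m) ⟩
  suc m ℕ.% suc m                   ≡⟨ n%n≡0 (suc m) ⟩
  0                                 ∎)
  where open ≡-Reasoning

rot⁻¹ : Fin (suc m) → Fin (suc m)
rot⁻¹ zero    = fromℕ _
rot⁻¹ (suc j) = inject₁ j

rot∘rot⁻¹ : (i : Fin (suc m)) → rot (rot⁻¹ i) ≡ i
rot∘rot⁻¹ zero    = rot-fromℕ
rot∘rot⁻¹ (suc j) = rot-inject₁ j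

rot⁻¹∘rot : (i : Fin (suc m)) → rot⁻¹ (rot i) ≡ i
rot⁻¹∘rot i with view i
... | ‵fromℕ     = cong rot⁻¹ rot-fromℕ
... | ‵inject₁ j = cong rot⁻¹ (rot-inject₁ j)

rotSign : Fin (suc m) → Bool
rotSign zero    = true
rotSign (suc _) = false

Mon-rotate⁻¹ : (x z : Fin (suc m) → Bool) → z zero ≡ not (x (fromℕ m)) →
               z ∘ suc ≗ x ∘ inject₁ → NonDecreasing x → Mon (suc m) z
Mon-rotate⁻¹ {m} x z z-head z-tail x↑ with x (fromℕ m) in x-last
... | true  = inj₁ (Sorted-cons R ≤-refl (λ j → subst (B._≤ z (suc j)) (sym z-head) (≤-minimum _))
                     (Sorted-resp-≗ R (sym ∘ z-tail) (Sorted-∘ R inject₁-mono-≤ x↑)))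
  where R = B._≤_
... | false = inj₂ (Sorted-cons R ≤-refl (λ j → subst (z (suc j) B.≤_) (sym z-head) (≤-maximum _))
                     (Sorted-resp-≗ R (sym ∘ z-tail)
                       (Sorted-∘ R inject₁-mono-≤ (nonDecreasing-last-false x↑ x-last))))
  where R = flip B._≤_

Mon-rotate : (y z : Fin (suc m) → Bool) → z (fromℕ m) ≡ not (y zero) →
             z ∘ inject₁ ≗ y ∘ suc → NonDecreasing y → Mon (suc m) z
Mon-rotate y z z-last z-init y↑ with y zero in y-first
... | false = inj₁ (Sorted-snoc R ≤-refl (λ i → subst (z (inject₁ i) B.≤_) (sym z-last) (≤-maximum _))
                     (Sorted-resp-≗ R (sym ∘ z-init) (Sorted-∘ R s≤s y↑)))
  where R = B._≤_
... | true  = inj₂ (Sorted-snoc R ≤-refl (λ i → subst (B._≤ z (inject₁ i)) (sym z-last) (≤-minimum _))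
                     (Sorted-resp-≗ R (sym ∘ z-init)
                       (Sorted-∘ R s≤s (nonDecreasing-first-true y↑ y-first))))
  where R = flip B._≤_

signedSymmetry-rot : SignedSymmetry (Mon (suc m)) rot
signedSymmetry-rot {m} = record
  { σ⁻¹ = rot⁻¹ ; σ⁻¹∘σ = rot⁻¹∘rot ; σ∘σ⁻¹ = rot∘rot⁻¹ ; sign = rotSign
  ; preserves = Mon-signedAct rotSign rot⁻¹ λ x → Mon-rotate⁻¹ x _ refl (λ _ → refl)
  ; preserves⁻¹ = Mon-signedAct (rotSign ∘ rot) rot λ y → Mon-rotate y _
      (cong (λ i → rotSign i xor y i) rot-fromℕ)
      (λ j → cong (λ i → rotSign i xor y i) (rot-inject₁ j))
  }

signedSymmetry-dihedral : {σ : Fin (suc m) → Fin (suc m)} → InDihedral σ →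
                          SignedSymmetry (Mon (suc m)) σ
signedSymmetry-dihedral gen-rot              = signedSymmetry-rot
signedSymmetry-dihedral gen-refl             = signedSymmetry-opposite
signedSymmetry-dihedral gen-id               = signedSymmetry-id Mon-resp-≗
signedSymmetry-dihedral (gen-comp σ τ)       =
  signedSymmetry-∘ Mon-resp-≗ (signedSymmetry-dihedral σ) (signedSymmetry-dihedral τ)
signedSymmetry-dihedral (gen-inv σ σ′∘σ σ∘σ′) =
  signedSymmetry-inverse Mon-resp-≗ (signedSymmetry-dihedral σ) σ′∘σ σ∘σ′
signedSymmetry-dihedral (gen-ext σ σ≗σ′)      =
  signedSymmetry-≗ Mon-resp-≗ (signedSymmetry-dihedral σ) σ≗σ′

preimage : (Fin n → Fin n) → Subset n → Subset n
preimage σ S = tabulate (lookup S ∘ σ)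

module _ {σ : Fin n → Fin n} {S : Subset n} where

  ∈-preimage⁺ : ∀ {t} → σ t ∈ S → t ∈ preimage σ S
  ∈-preimage⁺ {t} σt∈S =
    lookup⇒[]= t _ (trans (lookup∘tabulate (lookup S ∘ σ) t) ([]=⇒lookup σt∈S))

  ∈-preimage⁻ : ∀ {t} → t ∈ preimage σ S → σ t ∈ S
  ∈-preimage⁻ {t} t∈ =
    lookup⇒[]= (σ t) S (trans (sym (lookup∘tabulate (lookup S ∘ σ) t)) ([]=⇒lookup t∈))

  image-preimage : {σ⁻¹ : Fin n → Fin n} → (∀ i → σ (σ⁻¹ i) ≡ i) → ∀ i →
    (i ∈ S → Σ (Fin n) λ t → t ∈ preimage σ S × σ t ≡ i) ×
    ((Σ (Fin n) λ t → t ∈ preimage σ S × σ t ≡ i) → i ∈ S)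
  image-preimage {σ⁻¹} σ∘σ⁻¹ i =
    (λ i∈S → σ⁻¹ i , ∈-preimage⁺ (subst (_∈ S) (sym (σ∘σ⁻¹ i)) i∈S) , σ∘σ⁻¹ i) ,
    (λ { (t , t∈ , refl) → ∈-preimage⁻ t∈ })

inWindow-signedAct : ∀ {b j} {s : Fin n → Bool} {τ : Fin n → Fin n}
  (f : (Fin j → Fin b) → Fin n → Bool) {i k} →
  InWindow (signedAct s τ ∘ f) i k → InWindow f (τ i) k
inWindow-signedAct {s = s} f {i} k∈ W W-suff = k∈ W λ x y x≡y → cong (s i xor_) (W-suff x y x≡y)

generates-signedSymmetry : {L : Language Bool n} {σ : Fin n → Fin n} {K : Subset n → Set} →
                           SignedSymmetry L σ → Generates K L → Generates (act σ K) L
generates-signedSymmetry {n} {L} {σ} {K} G (b , j , f , (f-into , f-onto) , K-f⊆K) =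
  b , j , g , (g-into , g-onto) , K-g⊆σK
  where
  open SignedSymmetry G
  g : (Fin j → Fin b) → Fin n → Bool
  g = signedAct sign σ⁻¹ ∘ f
  g-into : ∀ x → L (g x)
  g-into x = preserves (f x) (f-into x)
  g-onto : ∀ y → L y → Σ (Fin j → Fin b) λ x → ∀ i → g x i ≡ y i
  g-onto y y∈L with f-onto _ (preserves⁻¹ y y∈L)
  ... | x , fx≗ = x , λ i →
    trans (cong (sign i xor_) (fx≗ (σ⁻¹ i))) (signedAct-inverse sign {σ} σ∘σ⁻¹ y i)
  K-g⊆σK : ∀ S → InCommComplex g S → act σ K S
  K-g⊆σK S (k , k∈windows) =
    preimage σ S ,
    K-f⊆K (preimage σ S) (k , λ t t∈ →
      subst (λ t′ → InWindow f t′ k) (σ⁻¹∘σ t)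
            (inWindow-signedAct {s = sign} {τ = σ⁻¹} f (k∈windows (σ t) (∈-preimage⁻ t∈)))) ,
    image-preimage σ∘σ⁻¹

proposition2p5 : (n : ℕ) → n ≥ 1 → (σ : Fin n → Fin n) → InDihedral σ →
    (K : Subset n → Set) → IsSimplicialComplex K →
    Generates K (Mon n) → Generates (act σ K) (Mon n)
proposition2p5 (suc m) _ _ σ∈D _ _ = generates-signedSymmetry (signedSymmetry-dihedral σ∈D)
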